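{- Let $\mathcal{F}$ be a set of symbols, $\mathcal{E}$ a set of equations and $\mathcal{R}$ a set of rewrite rules over the terms $\mathcal{T}$ described in the context, with $\sim$, $\to_\beta$ and $\rhd\!\!\!\!\rhd$ as defined there. Assume that $\mathcal{E}$ is linear. Then: (i) for all terms $t,t',u$, if $t\sim t'$ and $t'\to_\beta u$, then there exists a term $u'$ with $t\to_\beta u'$ and $u'\sim u$; (ii) for all terms $t,t',u$, if $t\sim t'$ and $t'\rhd\!\!\!\!\rhd u$, then there exists a term $u'$ with $t\rhd\!\!\!\!\rhd u'$ and $u'\sim u$. (That is, $\sim$ commutes with $\to_\beta$ and with $\rhd\!\!\!\!\rhd$.)
   Context: Terms (considered modulo renaming of bound variables): $t,u ::= s \mid x \mid f \mid [x:t]u \mid tu \mid (x:t)u$, where $s\in\{\star,\Box\}$ is a sort, $x$ ranges over an infinite set of variables, $f$ ranges over a set $\mathcal{F}$ of symbols, $[x:t]u$ is an abstraction (binding $x$ in $u$), $tu$ an application and $(x:t)u$ a dependent product (binding $x$ in $u$). Every symbol $f$ has an arity $\alpha_f\in\mathbb{N}$. A term is algebraic if it is built only from variables and applications $f t_1\ldots t_n$ with $n=\alpha_f$. $\mathrm{FV}(t)$ is the set of free variables of $t$; $t|_p$ is the subterm at position $p$ and $t[u]_p$ the replacement of $t|_p$ by $u$. A rewrite rule is a pair $l\to r$ of terms with $l$ algebraic, $l$ not a variable, and $\mathrm{FV}(r)\subseteq\mathrm{FV}(l)$. For a set of rules $\mathcal{R}$, $t\to_{\mathcal{R}} t'$ iff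 there are a position $p$, a rule $l\to r\in\mathcal{R}$ and a substitution $\sigma$ with $t|_p=l\sigma$ and $t'=t[r\sigma]_p$. $t\to_\beta t'$ iff there is a position $p$ with $t|_p=([x:U]v)\,u$ and $t'=t[v\{x\mapsto u\}]_p$. A set of equations $\mathcal{E}$ is a set of rewrite rules that is symmetric ($l\to r\in\mathcal{E}$ iff $r\to l\in\mathcal{E}$), such that for each $l\to r\in\mathcal{E}$ both $l$ and $r$ are algebraic, headed by a symbol, and $\mathrm{FV}(l)=\mathrm{FV}(r)$. $\mathcal{E}$ is linear if in every rule $l\to r$ of $\mathcal{E}$ no variable occurs more than once in $l$ and no variable occurs more than once in $r$. $\sim$ is the reflexive and transitive closure of $\to_{\mathcal{E}}$ (an equivalence relation). The relation $\rhd\!\!\!\!\rhd$ is defined by: $t\rhd\!\!\!\!\rhd u$ iff $t\to_\beta u$, or there exists $t'$ with $t\sim t'$ and $t'\to_{\mathcal{R}} u$. -}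

module Defs where

open import Data.Nat using (ℕ; zero; suc; _+_; _≤_)
open import Data.Product using (Σ; ∃; _×_; _,_)
open import Relation.Binary.PropositionalEquality using (_≡_)
import Data.Empty
import Relation.Nullary
open import Relation.Binary.Construct.Closure.ReflexiveTransitive using (Star)

data Sort : Set where
  ⋆ □ : Sort

-- Terms over a set of symbols F, modulo α-conversion: de Bruijn indices.
-- lam A u  is  [x:A]u ,  pi A u  is  (x:A)u  (x bound in u = index 0).
data Term (F : Set) : Set where
  sort : Sort → Term F
  var  : ℕ → Term F
  fun  : F → Term F
  lam  : Term F → Term F → Term F
  app  : Term F → Term F → Term F
  pi   : Term F → Term F → Term F

module Rewriting (F : Set) (arity : F → ℕ) where

  Tm : Set
  Tm = Term F

  ext : (ℕ → ℕ) → ℕ → ℕ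
  ext ρ zero    = zero
  ext ρ (suc n) = suc (ρ n)

  rename : (ℕ → ℕ) → Tm → Tm
  rename ρ (sort s)  = sort s
  rename ρ (var x)   = var (ρ x)
  rename ρ (fun f)   = fun f
  rename ρ (lam t u) = lam (rename ρ t) (rename (ext ρ) u)
  rename ρ (app t u) = app (rename ρ t) (rename ρ u)
  rename ρ (pi t u)  = pi (rename ρ t) (rename (ext ρ) u)

  exts : (ℕ → Tm) → ℕ → Tm
  exts σ zero    = var zero
  exts σ (suc n) = rename suc (σ n)

  subst : (ℕ → Tm) → Tm → Tm
  subst σ (sort s)  = sort s
  subst σ (var x)   = σ x
  subst σ (fun f)   = fun f
  subst σ (lam t u) = lam (subst σ t) (subst (exts σ) u)
  subst σ (app t u) = app (subst σ t) (subst σ u)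
  subst σ (pi t u)  = pi (subst σ t) (subst (exts σ) u)

  -- v{x ↦ u} for the variable bound at index 0
  sub0 : Tm → ℕ → Tm
  sub0 u zero    = u
  sub0 u (suc n) = var n

  _[_]₀ : Tm → Tm → Tm
  v [ u ]₀ = subst (sub0 u) v

  data _∈FV_ : ℕ → Tm → Set where
    fv-var  : ∀ {x} → x ∈FV var x
    fv-lamˡ : ∀ {x t u} → x ∈FV t → x ∈FV lam t u
    fv-lamʳ : ∀ {x t u} → suc x ∈FV u → x ∈FV lam t u
    fv-appˡ : ∀ {x t u} → x ∈FV t → x ∈FV app t u
    fv-appʳ : ∀ {x t u} → x ∈FV u → x ∈FV app t u
    fv-piˡ  : ∀ {x t u} → x ∈FV t → x ∈FV pi t u
    fv-piʳ  : ∀ {x t u} → suc x ∈FV u → x ∈FV pi t u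

  occ : ℕ → Tm → ℕ
  occ x (sort s) = 0
  occ x (var y) with x Data.Nat.≟ y
  ... | Relation.Nullary.yes _ = 1
  ... | Relation.Nullary.no _  = 0
  occ x (fun f)   = 0
  occ x (lam t u) = occ x t + occ (suc x) u
  occ x (app t u) = occ x t + occ x u
  occ x (pi t u)  = occ x t + occ (suc x) u

  -- algebraic terms: variables, and  f t₁ … tₙ  with n = arity f, tᵢ algebraic
  mutual
    data AlgSpine (f : F) : ℕ → Tm → Set where
      spine-head : AlgSpine f zero (fun f)
      spine-arg  : ∀ {n t u} → AlgSpine f n t → Algebraic u → AlgSpine f (suc n) (app t u)

    data Algebraic : Tm → Set where
      alg-var : ∀ {x} → Algebraic (var x)
      alg-fun : ∀ {f t} → AlgSpine f (arity f) t → Algebraic t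

  SymbolHeaded : Tm → Set
  SymbolHeaded t = Σ F λ f → AlgSpine f (arity f) t

  IsVar : Tm → Set
  IsVar t = Σ ℕ λ x → t ≡ var x

  RuleSet : Set₁
  RuleSet = Tm → Tm → Set

  IsRewriteRules : RuleSet → Set
  IsRewriteRules R = ∀ {l r} → R l r →
    Algebraic l × (IsVar l → Data.Empty.⊥) × (∀ x → x ∈FV r → x ∈FV l)

  IsEquations : RuleSet → Set
  IsEquations E =
    (∀ {l r} → E l r → E r l) ×
    (∀ {l r} → E l r →
       SymbolHeaded l × SymbolHeaded r ×
       (∀ x → x ∈FV l → x ∈FV r) × (∀ x → x ∈FV r → x ∈FV l))

  Linear : RuleSet → Set
  Linear E = ∀ {l r} → E l r → (∀ x → occ x l ≤ 1) × (∀ x → occ x r ≤ 1)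

  -- closure under contexts (rewriting at an arbitrary position p);
  -- positions under a binder see the bound variable as index 0.
  data Ctx (S : Tm → Tm → Set) : Tm → Tm → Set where
    top   : ∀ {t u} → S t u → Ctx S t u
    lamˡ  : ∀ {t t' u} → Ctx S t t' → Ctx S (lam t u) (lam t' u)
    lamʳ  : ∀ {t u u'} → Ctx S u u' → Ctx S (lam t u) (lam t u')
    appˡ  : ∀ {t t' u} → Ctx S t t' → Ctx S (app t u) (app t' u)
    appʳ  : ∀ {t u u'} → Ctx S u u' → Ctx S (app t u) (app t u')
    piˡ   : ∀ {t t' u} → Ctx S t t' → Ctx S (pi t u) (pi t' u)
    piʳ   : ∀ {t u u'} → Ctx S u u' → Ctx S (pi t u) (pi t u')

  data RuleStep (R : RuleSet) : Tm → Tm → Set where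
    inst : ∀ {l r} (σ : ℕ → Tm) → R l r → RuleStep R (subst σ l) (subst σ r)

  data BetaHead : Tm → Tm → Set where
    beta : ∀ {U v u} → BetaHead (app (lam U v) u) (v [ u ]₀)

  _⟶[_]_ : Tm → RuleSet → Tm → Set
  t ⟶[ R ] u = Ctx (RuleStep R) t u

  _⟶β_ : Tm → Tm → Set
  t ⟶β u = Ctx BetaHead t u

  _∼[_]_ : Tm → RuleSet → Tm → Set
  t ∼[ E ] u = Star (λ a b → a ⟶[ E ] b) t u

  data _⊳⊳[_,_]_ (t : Tm) (E R : RuleSet) (u : Tm) : Set where
    ⊳β : t ⟶β u → t ⊳⊳[ E , R ] u
    ⊳R : ∀ {t'} → t ∼[ E ] t' → t' ⟶[ R ] u → t ⊳⊳[ E , R ] u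

{-# OPTIONS --safe #-}
-- An E-step t ⟶ t' followed by a β-step t' ⟶ u either acts at disjoint positions, or
-- the E-step lies inside the β-redex, or the β-step lies inside the contractum rσ of
-- the E-step. In the second case contract first and replay the E-step on every copy of
-- the redex's argument, or once in its body (hence ∼ rather than one step). In the
-- third case r is algebraic and symbol-headed, so it neither contains nor creates a
-- redex and the step happens inside some σ x. Since r is linear, x occurs once in r and
-- the result is rσ' for σ' = σ[x ↦ s]; since FV r ⊆ FV l and l is linear, the same step
-- takes lσ to lσ', and lσ' ⟶ rσ' closes the diagram.
module Submission where

open import Defs
open import Data.Nat using (ℕ; zero; suc; _≤_; _<_; z≤n; s≤s; _≟_)
open import Data.Nat.Properties using (≤-trans; m≤m+n; m≤n+m; +-mono-≤)
open import Data.Product using (Σ; _×_; _,_; proj₁; proj₂)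
open import Data.Empty using (⊥; ⊥-elim)
open import Data.Unit using (⊤; tt)
open import Function using (_∘_)
open import Level using (Level)
open import Relation.Nullary using (¬_; yes; no)
open import Relation.Binary.Core using (Rel)
open import Relation.Binary.Construct.Composition using () renaming (_;_ to _⨾_)
open import Relation.Binary.PropositionalEquality as ≡ using (_≡_; refl; sym; trans; cong; cong₂)
open import Relation.Binary.Construct.Closure.ReflexiveTransitive using (Star; ε; _◅_; _◅◅_; gmap)

module _ {a ℓ₁ ℓ₂ : Level} {A : Set a} {S : Rel A ℓ₁} {T : Rel A ℓ₂} where

  star-commute : (∀ {x y z} → S x y → T y z → (T ⨾ Star S) x z) →
                 ∀ {x y z} → Star S x y → T y z → (T ⨾ Star S) x z
  star-commute commute ε t = _ , t , ε
  star-commute commute (s ◅ ss) t with star-commute commute ss t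
  ... | _ , t′ , ss′ with commute s t′
  ...   | _ , t″ , ss″ = _ , t″ , ss″ ◅◅ ss′

module Commutation (F : Set) (arity : F → ℕ) where
  open Rewriting F arity

  exts-cong : ∀ {σ τ : ℕ → Tm} → (∀ x → σ x ≡ τ x) → ∀ x → exts σ x ≡ exts τ x
  exts-cong eq zero    = refl
  exts-cong eq (suc x) = cong (rename suc) (eq x)

  subst-cong : ∀ {σ τ : ℕ → Tm} → (∀ x → σ x ≡ τ x) → ∀ t → subst σ t ≡ subst τ t
  subst-cong eq (sort s)  = refl
  subst-cong eq (var x)   = eq x
  subst-cong eq (fun f)   = refl
  subst-cong eq (lam t u) = cong₂ lam (subst-cong eq t) (subst-cong (exts-cong eq) u)
  subst-cong eq (app t u) = cong₂ app (subst-cong eq t) (subst-cong eq u)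
  subst-cong eq (pi t u)  = cong₂ pi (subst-cong eq t) (subst-cong (exts-cong eq) u)

  var-ext≡exts-var : ∀ (ρ : ℕ → ℕ) x → var (ext ρ x) ≡ exts (var ∘ ρ) x
  var-ext≡exts-var ρ zero    = refl
  var-ext≡exts-var ρ (suc x) = refl

  rename-as-subst : ∀ ρ t → rename ρ t ≡ subst (var ∘ ρ) t
  rename-as-subst ρ (sort s)  = refl
  rename-as-subst ρ (var x)   = refl
  rename-as-subst ρ (fun f)   = refl
  rename-as-subst ρ (lam t u) = cong₂ lam (rename-as-subst ρ t)
    (trans (rename-as-subst (ext ρ) u) (subst-cong (var-ext≡exts-var ρ) u))
  rename-as-subst ρ (app t u) = cong₂ app (rename-as-subst ρ t) (rename-as-subst ρ u)
  rename-as-subst ρ (pi t u)  = cong₂ pi (rename-as-subst ρ t)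
    (trans (rename-as-subst (ext ρ) u) (subst-cong (var-ext≡exts-var ρ) u))

  mutual
    subst-subst : ∀ τ σ {t} → Algebraic t → subst τ (subst σ t) ≡ subst (subst τ ∘ σ) t
    subst-subst τ σ alg-var      = refl
    subst-subst τ σ (alg-fun sp) = subst-subst-spine τ σ sp

    subst-subst-spine : ∀ τ σ {f n t} → AlgSpine f n t →
                        subst τ (subst σ t) ≡ subst (subst τ ∘ σ) t
    subst-subst-spine τ σ spine-head         = refl
    subst-subst-spine τ σ (spine-arg sp arg) =
      cong₂ app (subst-subst-spine τ σ sp) (subst-subst τ σ arg)

  AlgebraicRules : RuleSet → Set
  AlgebraicRules R = ∀ {l r} → R l r → Algebraic l × Algebraic r

  module _ {R : RuleSet} (algebraic : AlgebraicRules R) where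

    ⟶-subst : ∀ τ {t u} → t ⟶[ R ] u → subst τ t ⟶[ R ] subst τ u
    ⟶-subst τ (top (inst σ rule))
      rewrite subst-subst τ σ (proj₁ (algebraic rule))
            | subst-subst τ σ (proj₂ (algebraic rule)) = top (inst (subst τ ∘ σ) rule)
    ⟶-subst τ (lamˡ step) = lamˡ (⟶-subst τ step)
    ⟶-subst τ (lamʳ step) = lamʳ (⟶-subst (exts τ) step)
    ⟶-subst τ (appˡ step) = appˡ (⟶-subst τ step)
    ⟶-subst τ (appʳ step) = appʳ (⟶-subst τ step)
    ⟶-subst τ (piˡ step)  = piˡ (⟶-subst τ step)
    ⟶-subst τ (piʳ step)  = piʳ (⟶-subst (exts τ) step)

    ⟶-rename : ∀ ρ {t u} → t ⟶[ R ] u → rename ρ t ⟶[ R ] rename ρ u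
    ⟶-rename ρ {t} {u} step
      rewrite rename-as-subst ρ t | rename-as-subst ρ u = ⟶-subst (var ∘ ρ) step

    ∼-exts : ∀ {σ τ} → (∀ x → σ x ∼[ R ] τ x) → ∀ x → exts σ x ∼[ R ] exts τ x
    ∼-exts σ∼τ zero    = ε
    ∼-exts σ∼τ (suc x) = gmap (rename suc) (⟶-rename suc) (σ∼τ x)

    ∼-subst : ∀ {σ τ} → (∀ x → σ x ∼[ R ] τ x) → ∀ t → subst σ t ∼[ R ] subst τ t
    ∼-subst σ∼τ (sort s)  = ε
    ∼-subst σ∼τ (var x)   = σ∼τ x
    ∼-subst σ∼τ (fun f)   = ε
    ∼-subst σ∼τ (lam t u) =
      gmap _ lamˡ (∼-subst σ∼τ t) ◅◅ gmap _ lamʳ (∼-subst (∼-exts σ∼τ) u)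
    ∼-subst σ∼τ (app t u) =
      gmap _ appˡ (∼-subst σ∼τ t) ◅◅ gmap _ appʳ (∼-subst σ∼τ u)
    ∼-subst σ∼τ (pi t u)  =
      gmap _ piˡ (∼-subst σ∼τ t) ◅◅ gmap _ piʳ (∼-subst (∼-exts σ∼τ) u)

    ∼-sub0 : ∀ {u u'} → u ∼[ R ] u' → ∀ x → sub0 u x ∼[ R ] sub0 u' x
    ∼-sub0 u∼u' zero    = u∼u'
    ∼-sub0 u∼u' (suc x) = ε

  record LinearTerm (t : Tm) : Set where
    constructor linear
    field occ≤1 : ∀ x → occ x t ≤ 1
  open LinearTerm

  linear-appˡ : ∀ {t u} → LinearTerm (app t u) → LinearTerm t
  linear-appˡ {t} {u} lin = linear λ x → ≤-trans (m≤m+n (occ x t) (occ x u)) (occ≤1 lin x)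

  linear-appʳ : ∀ {t u} → LinearTerm (app t u) → LinearTerm u
  linear-appʳ {t} {u} lin = linear λ x → ≤-trans (m≤n+m (occ x u) (occ x t)) (occ≤1 lin x)

  ∈FV⇒0<occ : ∀ {x t} → x ∈FV t → 0 < occ x t
  ∈FV⇒0<occ {x} fv-var with x ≟ x
  ... | yes _   = s≤s z≤n
  ... | no x≢x = ⊥-elim (x≢x refl)
  ∈FV⇒0<occ (fv-lamˡ x∈t) = ≤-trans (∈FV⇒0<occ x∈t) (m≤m+n _ _)
  ∈FV⇒0<occ (fv-lamʳ x∈u) = ≤-trans (∈FV⇒0<occ x∈u) (m≤n+m _ _)
  ∈FV⇒0<occ (fv-appˡ x∈t) = ≤-trans (∈FV⇒0<occ x∈t) (m≤m+n _ _)
  ∈FV⇒0<occ (fv-appʳ x∈u) = ≤-trans (∈FV⇒0<occ x∈u) (m≤n+m _ _)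
  ∈FV⇒0<occ (fv-piˡ x∈t)  = ≤-trans (∈FV⇒0<occ x∈t) (m≤m+n _ _)
  ∈FV⇒0<occ (fv-piʳ x∈u)  = ≤-trans (∈FV⇒0<occ x∈u) (m≤n+m _ _)

  linear-app-disjoint : ∀ {x t u} → LinearTerm (app t u) → x ∈FV t → ¬ x ∈FV u
  linear-app-disjoint lin x∈t x∈u
    with ≤-trans (+-mono-≤ (∈FV⇒0<occ x∈t) (∈FV⇒0<occ x∈u)) (occ≤1 lin _)
  ... | s≤s ()

  _[_↦_] : (ℕ → Tm) → ℕ → Tm → ℕ → Tm
  (σ [ x ↦ s ]) y with x ≟ y
  ... | yes _ = s
  ... | no _  = σ y

  update-same : ∀ σ x s → (σ [ x ↦ s ]) x ≡ s
  update-same σ x s with x ≟ x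
  ... | yes _  = refl
  ... | no x≢x = ⊥-elim (x≢x refl)

  mutual
    subst-update-fresh : ∀ σ {x} s {t} → Algebraic t → ¬ x ∈FV t →
                         subst (σ [ x ↦ s ]) t ≡ subst σ t
    subst-update-fresh σ {x} s (alg-var {y}) x∉t with x ≟ y
    ... | yes refl = ⊥-elim (x∉t fv-var)
    ... | no _     = refl
    subst-update-fresh σ s (alg-fun sp) x∉t = subst-update-fresh-spine σ s sp x∉t

    subst-update-fresh-spine : ∀ σ {x} s {f n t} → AlgSpine f n t → ¬ x ∈FV t →
                               subst (σ [ x ↦ s ]) t ≡ subst σ t
    subst-update-fresh-spine σ s spine-head         x∉t = refl
    subst-update-fresh-spine σ s (spine-arg sp arg) x∉t =
      cong₂ app (subst-update-fresh-spine σ s sp (x∉t ∘ fv-appˡ))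
                (subst-update-fresh σ s arg (x∉t ∘ fv-appʳ))

  NotLam : Tm → Set
  NotLam (lam _ _) = ⊥
  NotLam _         = ⊤

  notLam-subst-spine : ∀ σ {f n t} → AlgSpine f n t → NotLam (subst σ t)
  notLam-subst-spine σ spine-head      = tt
  notLam-subst-spine σ (spine-arg _ _) = tt

  data AppStep (t u : Tm) : Tm → Set where
    inFun : ∀ {t'} → t ⟶β t' → AppStep t u (app t' u)
    inArg : ∀ {u'} → u ⟶β u' → AppStep t u (app t u')

  app-⟶β-inv : ∀ {t u v} → app t u ⟶β v → NotLam t → AppStep t u v
  app-⟶β-inv (top beta)  ()
  app-⟶β-inv (appˡ step) _ = inFun step
  app-⟶β-inv (appʳ step) _ = inArg step

  data InsideSubst (σ : ℕ → Tm) (t : Tm) : Tm → Set where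
    at : ∀ {x s} → x ∈FV t → σ x ⟶β s → InsideSubst σ t (subst (σ [ x ↦ s ]) t)

  mutual
    ⟶β-linear-instance : ∀ σ {t u} → Algebraic t → LinearTerm t → subst σ t ⟶β u →
                         InsideSubst σ t u
    ⟶β-linear-instance σ (alg-var {x}) lin step =
      ≡.subst (InsideSubst σ (var x)) (update-same σ x _) (at fv-var step)
    ⟶β-linear-instance σ (alg-fun sp) lin step = ⟶β-linear-instance-spine σ sp lin step

    ⟶β-linear-instance-spine : ∀ σ {f n t u} → AlgSpine f n t → LinearTerm t →
                               subst σ t ⟶β u → InsideSubst σ t u
    ⟶β-linear-instance-spine σ spine-head lin (top ())
    ⟶β-linear-instance-spine σ (spine-arg sp arg) lin step
      with app-⟶β-inv step (notLam-subst-spine σ sp)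
    ... | inFun step' with ⟶β-linear-instance-spine σ sp (linear-appˡ lin) step'
    ...   | at x∈t σx⟶s =
      ≡.subst (InsideSubst σ _)
        (cong (app _) (subst-update-fresh σ _ arg (linear-app-disjoint lin x∈t)))
        (at (fv-appˡ x∈t) σx⟶s)
    ⟶β-linear-instance-spine σ (spine-arg sp arg) lin step
        | inArg step' with ⟶β-linear-instance σ arg (linear-appʳ lin) step'
    ...   | at x∈u σx⟶s =
      ≡.subst (InsideSubst σ _)
        (cong (λ w → app w _)
          (subst-update-fresh-spine σ _ sp (λ x∈t → linear-app-disjoint lin x∈t x∈u)))
        (at (fv-appʳ x∈u) σx⟶s)

  mutual
    ⟶β-lift-instance : ∀ σ {x s t} → Algebraic t → LinearTerm t → x ∈FV t → σ x ⟶β s →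
                       subst σ t ⟶β subst (σ [ x ↦ s ]) t
    ⟶β-lift-instance σ {x} {s} alg-var lin fv-var σx⟶s
      rewrite update-same σ x s = σx⟶s
    ⟶β-lift-instance σ (alg-fun sp) lin x∈t σx⟶s = ⟶β-lift-instance-spine σ sp lin x∈t σx⟶s

    ⟶β-lift-instance-spine : ∀ σ {x s f n t} → AlgSpine f n t → LinearTerm t → x ∈FV t →
                             σ x ⟶β s → subst σ t ⟶β subst (σ [ x ↦ s ]) t
    ⟶β-lift-instance-spine σ spine-head lin () σx⟶s
    ⟶β-lift-instance-spine σ (spine-arg sp arg) lin (fv-appˡ x∈t) σx⟶s =
      ≡.subst (λ w → _ ⟶β app _ w)
        (sym (subst-update-fresh σ _ arg (linear-app-disjoint lin x∈t)))
        (appˡ (⟶β-lift-instance-spine σ sp (linear-appˡ lin) x∈t σx⟶s))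
    ⟶β-lift-instance-spine σ (spine-arg sp arg) lin (fv-appʳ x∈u) σx⟶s =
      ≡.subst (λ w → _ ⟶β app w _)
        (sym (subst-update-fresh-spine σ _ sp (λ x∈t → linear-app-disjoint lin x∈t x∈u)))
        (appʳ (⟶β-lift-instance σ arg (linear-appʳ lin) x∈u σx⟶s))

  module WithEquations
      (E : RuleSet)
      (headed : ∀ {l r} → E l r → SymbolHeaded l × SymbolHeaded r)
      (fv-rhs⊆fv-lhs : ∀ {l r} → E l r → ∀ x → x ∈FV r → x ∈FV l)
      (linear-rules : Linear E) where

    _⟶E_ _∼_ : Rel Tm _
    t ⟶E u = t ⟶[ E ] u
    t ∼ u  = t ∼[ E ] u

    algebraic : AlgebraicRules E
    algebraic e = alg-fun (proj₂ (proj₁ (headed e))) , alg-fun (proj₂ (proj₂ (headed e)))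

    ruleStep-notLam : ∀ {t u} → RuleStep E t u → NotLam u
    ruleStep-notLam (inst σ e) = notLam-subst-spine σ (proj₂ (proj₂ (headed e)))

    ruleStep-⟶β-commute : ∀ {t t' u} → RuleStep E t t' → t' ⟶β u → (_⟶β_ ⨾ _∼_) t u
    ruleStep-⟶β-commute (inst {l} σ e) step
      with ⟶β-linear-instance σ (proj₂ (algebraic e)) (linear (proj₂ (linear-rules e))) step
    ... | at {x} {s} x∈r σx⟶s =
      subst (σ [ x ↦ s ]) l ,
      ⟶β-lift-instance σ (proj₁ (algebraic e)) (linear (proj₁ (linear-rules e)))
                         (fv-rhs⊆fv-lhs e x x∈r) σx⟶s ,
      top (inst (σ [ x ↦ s ]) e) ◅ ε

    map-commute : ∀ (C : Tm → Tm) → (∀ {t u} → t ⟶β u → C t ⟶β C u) →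
                  (∀ {t u} → t ⟶E u → C t ⟶E C u) →
                  ∀ {t u} → (_⟶β_ ⨾ _∼_) t u → (_⟶β_ ⨾ _∼_) (C t) (C u)
    map-commute C β-cong E-cong (v , t⟶v , v∼u) = C v , β-cong t⟶v , gmap C E-cong v∼u

    ⟶E-⟶β-commute : ∀ {t t' u} → t ⟶E t' → t' ⟶β u → (_⟶β_ ⨾ _∼_) t u
    ⟶E-⟶β-commute (top rule)  step        = ruleStep-⟶β-commute rule step
    ⟶E-⟶β-commute (lamˡ e)    (top ())
    ⟶E-⟶β-commute (lamˡ e)    (lamˡ step) = map-commute _ lamˡ lamˡ (⟶E-⟶β-commute e step)
    ⟶E-⟶β-commute (lamˡ e)    (lamʳ step) = _ , lamʳ step , lamˡ e ◅ ε
    ⟶E-⟶β-commute (lamʳ e)    (top ())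
    ⟶E-⟶β-commute (lamʳ e)    (lamˡ step) = _ , lamˡ step , lamʳ e ◅ ε
    ⟶E-⟶β-commute (lamʳ e)    (lamʳ step) = map-commute _ lamʳ lamʳ (⟶E-⟶β-commute e step)
    ⟶E-⟶β-commute (piˡ e)     (top ())
    ⟶E-⟶β-commute (piˡ e)     (piˡ step)  = map-commute _ piˡ piˡ (⟶E-⟶β-commute e step)
    ⟶E-⟶β-commute (piˡ e)     (piʳ step)  = _ , piʳ step , piˡ e ◅ ε
    ⟶E-⟶β-commute (piʳ e)     (top ())
    ⟶E-⟶β-commute (piʳ e)     (piˡ step)  = _ , piˡ step , piʳ e ◅ ε
    ⟶E-⟶β-commute (piʳ e)     (piʳ step)  = map-commute _ piʳ piʳ (⟶E-⟶β-commute e step)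
    ⟶E-⟶β-commute (appˡ (top rule)) (top beta) = ⊥-elim (ruleStep-notLam rule)
    ⟶E-⟶β-commute (appˡ (lamˡ e))   (top beta) = _ , top beta , ε
    ⟶E-⟶β-commute (appˡ (lamʳ e))   (top beta) = _ , top beta , ⟶-subst algebraic _ e ◅ ε
    ⟶E-⟶β-commute (appˡ e)    (appˡ step) = map-commute _ appˡ appˡ (⟶E-⟶β-commute e step)
    ⟶E-⟶β-commute (appˡ e)    (appʳ step) = _ , appʳ step , appˡ e ◅ ε
    ⟶E-⟶β-commute (appʳ e)    (top (beta {v = v})) =
      _ , top beta , ∼-subst algebraic (∼-sub0 algebraic (e ◅ ε)) v
    ⟶E-⟶β-commute (appʳ e)    (appˡ step) = _ , appˡ step , appʳ e ◅ ε
    ⟶E-⟶β-commute (appʳ e)    (appʳ step) = map-commute _ appʳ appʳ (⟶E-⟶β-commute e step)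

    ∼-⟶β-commute : ∀ {t t' u} → t ∼ t' → t' ⟶β u → (_⟶β_ ⨾ _∼_) t u
    ∼-⟶β-commute = star-commute ⟶E-⟶β-commute

    ∼-⊳⊳-commute : ∀ R {t t' u} → t ∼ t' → t' ⊳⊳[ E , R ] u →
                   ((λ v w → v ⊳⊳[ E , R ] w) ⨾ _∼_) t u
    ∼-⊳⊳-commute R t∼t' (⊳β step) with ∼-⟶β-commute t∼t' step
    ... | v , t⟶v , v∼u = v , ⊳β t⟶v , v∼u
    ∼-⊳⊳-commute R t∼t' (⊳R t'∼t'' step) = _ , ⊳R (t∼t' ◅◅ t'∼t'') step , ε

lemma3 : (F : Set) (arity : F → ℕ) (E R : Rewriting.RuleSet F arity) →
         Rewriting.IsEquations F arity E →
         Rewriting.IsRewriteRules F arity R →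
         Rewriting.Linear F arity E →
         let open Rewriting F arity in
         (∀ t t' u → t ∼[ E ] t' → t' ⟶β u →
            Σ Tm λ u' → (t ⟶β u') × (u' ∼[ E ] u)) ×
         (∀ t t' u → t ∼[ E ] t' → t' ⊳⊳[ E , R ] u →
            Σ Tm λ u' → (t ⊳⊳[ E , R ] u') × (u' ∼[ E ] u))
lemma3 F arity E R (_ , shape) _ linear-rules =
  (λ _ _ _ → ∼-⟶β-commute) , (λ _ _ _ → ∼-⊳⊳-commute R)
  where
    open Rewriting F arity

    headed : ∀ {l r} → E l r → SymbolHeaded l × SymbolHeaded r
    headed e = let (l-headed , r-headed , _) = shape e in l-headed , r-headed

    fv-rhs⊆fv-lhs : ∀ {l r} → E l r → ∀ x → x ∈FV r → x ∈FV l
    fv-rhs⊆fv-lhs e = let (_ , _ , _ , r⊆l) = shape e in r⊆l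

    open Commutation.WithEquations F arity E headed fv-rhs⊆fv-lhs linear-rules
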